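{- For each non-negative integer $n$, \[ 3^n\sum_{k=0}^n (-1)^{k} \binom {n+k}{k} F_{2(n+1+2k)} = 1 - \sum_{k=0}^{n-1} (-3)^{k} \binom {2k+1}{k} \big(3 F_{6k+8} + F_{6k+10}\big), \] \[ 3^n\sum_{k=0}^n (-1)^{k}\binom {n+k}{k} L_{2(n+1+2k)} = 3 - \sum_{k=0}^{n-1} (-3)^{k}\binom {2k+1}{k} \big(3 L_{6k+8} + L_{6k+10}\big). \]
   Context: $F_j$ and $L_j$ denote the Fibonacci and Lucas numbers: $F_0=0,F_1=1$, $L_0=2,L_1=1$, both satisfying $X_j=X_{j-1}+X_{j-2}$. -}

module Defs where

open import Data.Nat as ℕ using (ℕ; zero; suc)
open import Data.Nat.Combinatorics using (_C_)
open import Data.Integer using (ℤ; +_; _+_; _*_; -_; _^_)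

F : ℕ → ℕ
F zero = 0
F (suc zero) = 1
F (suc (suc j)) = F (suc j) ℕ.+ F j

L : ℕ → ℕ
L zero = 2
L (suc zero) = 1
L (suc (suc j)) = L (suc j) ℕ.+ L j

sumBelow : ℕ → (ℕ → ℤ) → ℤ
sumBelow zero f = + 0
sumBelow (suc m) f = sumBelow m f + f m

neg1^ : ℕ → ℤ
neg1^ k = (- + 1) ^ k

neg3^ : ℕ → ℤ
neg3^ k = (- + 3) ^ k

-- Any sequence with X (j+2) = X (j+1) + X j satisfies X (j+4) + X j = 3 X (j+2). Write
-- A_n(g) = Σ_{k≤n} (-1)^k C(n+k,k) g k and g k = X (2(n+1+2k)). The sequence summed at stage n+1 is
-- X (2(n+2+2k)) = X (2 + 2(n+1+2k)), so three times it is g k + g (k+1), and the stage-(n+1) sum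
-- becomes A_{n+1}(g) + A_{n+1}(g ∘ suc). Pascal's rule C(n+k+2,k+1) = C(n+k+1,k+1) + C(n+k+1,k)
-- telescopes this to A_n(g) minus a boundary term, and since C(2n+2,n+1) = 2 C(2n+1,n) that term
-- times 3^n is exactly the n-th summand on the right. Induction on n gives both identities, the
-- constants 1 = F 2 and 3 = L 2 being the case n = 0.
module Submission where

open import Defs
open import Data.Nat as ℕ using (ℕ; zero; suc)
open import Data.Nat.Combinatorics using (_C_; nCk+nC[k+1]≡[n+1]C[k+1]; nCk≡nC[n∸k])
open import Data.Integer using (ℤ; +_; _+_; _-_; _*_; _^_; -_)
open import Data.Product using (_×_; _,_)
open import Function using (_∘_)
open import Relation.Binary.PropositionalEquality
import Data.Nat.Properties as ℕP
import Data.Integer.Properties as ℤP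
import Data.Nat.Tactic.RingSolver as ℕSolver
open import Data.Integer.Tactic.RingSolver using (solve-∀)

sumBelow-cong : ∀ m {f g : ℕ → ℤ} → (∀ k → f k ≡ g k) → sumBelow m f ≡ sumBelow m g
sumBelow-cong zero    f≗g = refl
sumBelow-cong (suc m) f≗g = cong₂ _+_ (sumBelow-cong m f≗g) (f≗g m)

sumBelow-suc : ∀ m (f : ℕ → ℤ) → sumBelow (suc m) f ≡ f 0 + sumBelow m (f ∘ suc)
sumBelow-suc zero    f = trans (ℤP.+-identityˡ (f 0)) (sym (ℤP.+-identityʳ (f 0)))
sumBelow-suc (suc m) f = trans (cong (_+ f (suc m)) (sumBelow-suc m f))
  (ℤP.+-assoc (f 0) (sumBelow m (f ∘ suc)) (f (suc m)))

sumBelow-+ : ∀ m (f g : ℕ → ℤ) → sumBelow m (λ k → f k + g k) ≡ sumBelow m f + sumBelow m g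
sumBelow-+ zero    f g = refl
sumBelow-+ (suc m) f g =
  trans (cong (_+ (f m + g m)) (sumBelow-+ m f g)) (interchange (sumBelow m f) (sumBelow m g) (f m) (g m))
  where
  interchange : ∀ a b c d → (a + b) + (c + d) ≡ (a + c) + (b + d)
  interchange = solve-∀

sumBelow-*ˡ : ∀ m (a : ℤ) (f : ℕ → ℤ) → sumBelow m (λ k → a * f k) ≡ a * sumBelow m f
sumBelow-*ˡ zero    a f = sym (ℤP.*-zeroʳ a)
sumBelow-*ˡ (suc m) a f =
  trans (cong (_+ (a * f m)) (sumBelow-*ˡ m a f)) (sym (ℤP.*-distribˡ-+ a (sumBelow m f) (f m)))

[m+n]Cm≡[m+n]Cn : ∀ m n → (m ℕ.+ n) C m ≡ (m ℕ.+ n) C n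
[m+n]Cm≡[m+n]Cn m n = trans (nCk≡nC[n∸k] (ℕP.m≤m+n m n)) (cong ((m ℕ.+ n) C_) (ℕP.m+n∸m≡n m n))

pascal-diagonal : ∀ n k → (suc n ℕ.+ suc k) C suc k ≡ (n ℕ.+ suc k) C suc k ℕ.+ (suc n ℕ.+ k) C k
pascal-diagonal n k = begin
  suc (n ℕ.+ suc k) C suc k                       ≡⟨ cong (λ m → suc m C suc k) (ℕP.+-suc n k) ⟩
  suc (suc n ℕ.+ k) C suc k                       ≡⟨ sym (nCk+nC[k+1]≡[n+1]C[k+1] (suc n ℕ.+ k) k) ⟩
  (suc n ℕ.+ k) C k ℕ.+ (suc n ℕ.+ k) C suc k     ≡⟨ ℕP.+-comm ((suc n ℕ.+ k) C k) _ ⟩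
  (suc n ℕ.+ k) C suc k ℕ.+ (suc n ℕ.+ k) C k     ≡⟨ cong (λ m → m C suc k ℕ.+ (suc n ℕ.+ k) C k) (sym (ℕP.+-suc n k)) ⟩
  (n ℕ.+ suc k) C suc k ℕ.+ (suc n ℕ.+ k) C k     ∎
  where open ≡-Reasoning

n+[1+n]≡2n+1 : ∀ n → n ℕ.+ suc n ≡ 2 ℕ.* n ℕ.+ 1
n+[1+n]≡2n+1 = ℕSolver.solve-∀

[n+1+n]C[1+n]≡[2n+1]Cn : ∀ n → (n ℕ.+ suc n) C suc n ≡ (2 ℕ.* n ℕ.+ 1) C n
[n+1+n]C[1+n]≡[2n+1]Cn n =
  trans (sym ([m+n]Cm≡[m+n]Cn n (suc n))) (cong (_C n) (n+[1+n]≡2n+1 n))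

[2+2n]C[1+n]≡2*[2n+1]Cn : ∀ n → (suc n ℕ.+ suc n) C suc n ≡ 2 ℕ.* ((2 ℕ.* n ℕ.+ 1) C n)
[2+2n]C[1+n]≡2*[2n+1]Cn n = begin
  suc (n ℕ.+ suc n) C suc n                               ≡⟨ sym (nCk+nC[k+1]≡[n+1]C[k+1] (n ℕ.+ suc n) n) ⟩
  (n ℕ.+ suc n) C n ℕ.+ (n ℕ.+ suc n) C suc n             ≡⟨ cong (ℕ._+ (n ℕ.+ suc n) C suc n) ([m+n]Cm≡[m+n]Cn n (suc n)) ⟩
  (n ℕ.+ suc n) C suc n ℕ.+ (n ℕ.+ suc n) C suc n         ≡⟨ cong (λ m → m ℕ.+ m) ([n+1+n]C[1+n]≡[2n+1]Cn n) ⟩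
  (2 ℕ.* n ℕ.+ 1) C n ℕ.+ (2 ℕ.* n ℕ.+ 1) C n             ≡⟨ cong ((2 ℕ.* n ℕ.+ 1) C n ℕ.+_) (sym (ℕP.+-identityʳ _)) ⟩
  2 ℕ.* ((2 ℕ.* n ℕ.+ 1) C n)                             ∎
  where open ≡-Reasoning

neg3^≡neg1^*3^ : ∀ n → neg3^ n ≡ neg1^ n * (+ 3) ^ n
neg3^≡neg1^*3^ zero    = refl
neg3^≡neg1^*3^ (suc n) = trans (cong ((- + 3) *_) (neg3^≡neg1^*3^ n)) (factor (neg1^ n) ((+ 3) ^ n))
  where
  factor : ∀ a b → (- + 3) * (a * b) ≡ ((- + 1) * a) * (+ 3 * b)
  factor = solve-∀

altBinom : ℕ → (ℕ → ℤ) → ℤ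
altBinom n g = sumBelow (suc n) (λ k → neg1^ k * + ((n ℕ.+ k) C k) * g k)

altBinom-cong : ∀ n {f g : ℕ → ℤ} → (∀ k → f k ≡ g k) → altBinom n f ≡ altBinom n g
altBinom-cong n f≗g = sumBelow-cong (suc n) (λ k → cong (neg1^ k * + ((n ℕ.+ k) C k) *_) (f≗g k))

altBinom-+ : ∀ n (f g : ℕ → ℤ) → altBinom n (λ k → f k + g k) ≡ altBinom n f + altBinom n g
altBinom-+ n f g = trans (sumBelow-cong (suc n) (λ k → ℤP.*-distribˡ-+ (neg1^ k * + ((n ℕ.+ k) C k)) (f k) (g k)))
                         (sumBelow-+ (suc n) _ _)

altBinom-*ˡ : ∀ n (a : ℤ) (f : ℕ → ℤ) → altBinom n (λ k → a * f k) ≡ a * altBinom n f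
altBinom-*ˡ n a f = trans (sumBelow-cong (suc n) (λ k → swap (neg1^ k * + ((n ℕ.+ k) C k)) a (f k)))
                          (sumBelow-*ˡ (suc n) a _)
  where
  swap : ∀ s a x → s * (a * x) ≡ a * (s * x)
  swap = solve-∀

altBinom-suc : ∀ n (g : ℕ → ℤ) →
  altBinom (suc n) g + altBinom (suc n) (g ∘ suc) ≡
  altBinom n g - neg1^ n * + ((2 ℕ.* n ℕ.+ 1) C n) * (g (suc n) + + 2 * g (suc (suc n)))
altBinom-suc n g = begin
  altBinom (suc n) g + (sumBelow (suc n) V + V (suc n))
    ≡⟨ cong (_+ (sumBelow (suc n) V + V (suc n))) (sumBelow-suc (suc n) T) ⟩
  (T 0 + sumBelow (suc n) (T ∘ suc)) + (sumBelow (suc n) V + V (suc n))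
    ≡⟨ reassociate (T 0) (sumBelow (suc n) (T ∘ suc)) (sumBelow (suc n) V) (V (suc n)) ⟩
  (T 0 + (sumBelow (suc n) (T ∘ suc) + sumBelow (suc n) V)) + V (suc n)
    ≡⟨ cong (λ s → (T 0 + s) + V (suc n)) (trans (sym (sumBelow-+ (suc n) (T ∘ suc) V)) (sumBelow-cong (suc n) pascal-term)) ⟩
  (W 0 + sumBelow (suc n) (W ∘ suc)) + V (suc n)
    ≡⟨ cong (_+ V (suc n)) (sym (sumBelow-suc (suc n) W)) ⟩
  (altBinom n g + W (suc n)) + V (suc n)
    ≡⟨ cong₂ (λ a b → (altBinom n g + neg1^ (suc n) * a * g (suc n)) + neg1^ (suc n) * b * g (suc (suc n)))
             (cong +_ ([n+1+n]C[1+n]≡[2n+1]Cn n))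
             (trans (cong +_ ([2+2n]C[1+n]≡2*[2n+1]Cn n)) (ℤP.pos-* 2 ((2 ℕ.* n ℕ.+ 1) C n))) ⟩
  (altBinom n g + neg1^ (suc n) * B * g (suc n)) + neg1^ (suc n) * (+ 2 * B) * g (suc (suc n))
    ≡⟨ collect (altBinom n g) (neg1^ n) B (g (suc n)) (g (suc (suc n))) ⟩
  altBinom n g - neg1^ n * B * (g (suc n) + + 2 * g (suc (suc n)))
    ∎
  where
  open ≡-Reasoning
  B : ℤ
  B = + ((2 ℕ.* n ℕ.+ 1) C n)
  -- T 0 and W 0 coincide definitionally, since m C 0 computes to 1.
  T W V : ℕ → ℤ
  T k = neg1^ k * + ((suc n ℕ.+ k) C k) * g k
  W k = neg1^ k * + ((n ℕ.+ k) C k) * g k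
  V k = neg1^ k * + ((suc n ℕ.+ k) C k) * g (suc k)
  pascal-term : ∀ k → T (suc k) + V k ≡ W (suc k)
  pascal-term k = trans (cong (λ c → neg1^ (suc k) * c * g (suc k) + V k) (cong +_ (pascal-diagonal n k)))
                        (cancel (neg1^ k) (+ ((n ℕ.+ suc k) C suc k)) (+ ((suc n ℕ.+ k) C k)) (g (suc k)))
    where
    cancel : ∀ s a b x → ((- + 1) * s) * (a + b) * x + s * b * x ≡ ((- + 1) * s) * a * x
    cancel = solve-∀
  reassociate : ∀ a b c d → (a + b) + (c + d) ≡ (a + (b + c)) + d
  reassociate = solve-∀
  collect : ∀ a s b y z → (a + ((- + 1) * s) * b * y) + ((- + 1) * s) * (+ 2 * b) * z ≡ a - s * b * (y + + 2 * z)
  collect = solve-∀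

module FibonacciLike (X : ℕ → ℤ) (X-rec : ∀ j → X (2 ℕ.+ j) ≡ X (1 ℕ.+ j) + X j) where

  X[4+j]+Xj≡3*X[2+j] : ∀ j → X (4 ℕ.+ j) + X j ≡ + 3 * X (2 ℕ.+ j)
  X[4+j]+Xj≡3*X[2+j] j = begin
    X (4 ℕ.+ j) + X j                               ≡⟨ cong (_+ X j) (trans (X-rec (2 ℕ.+ j)) (cong (_+ X (2 ℕ.+ j)) (X-rec (1 ℕ.+ j)))) ⟩
    ((X (2 ℕ.+ j) + X (1 ℕ.+ j)) + X (2 ℕ.+ j)) + X j ≡⟨ regroup (X (2 ℕ.+ j)) (X (1 ℕ.+ j)) (X j) ⟩
    + 2 * X (2 ℕ.+ j) + (X (1 ℕ.+ j) + X j)         ≡⟨ cong (λ x → + 2 * X (2 ℕ.+ j) + x) (sym (X-rec j)) ⟩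
    + 2 * X (2 ℕ.+ j) + X (2 ℕ.+ j)                 ≡⟨ triple (X (2 ℕ.+ j)) ⟩
    + 3 * X (2 ℕ.+ j)                               ∎
    where
    open ≡-Reasoning
    regroup : ∀ a b x → ((a + b) + a) + x ≡ + 2 * a + (b + x)
    regroup = solve-∀
    triple : ∀ a → + 2 * a + a ≡ + 3 * a
    triple = solve-∀

  lhs : ℕ → ℤ
  lhs n = (+ 3) ^ n * altBinom n (λ k → X (2 ℕ.* (n ℕ.+ 1 ℕ.+ 2 ℕ.* k)))

  summand : ℕ → ℤ
  summand k = neg3^ k * + ((2 ℕ.* k ℕ.+ 1) C k) * (+ 3 * X (6 ℕ.* k ℕ.+ 8) + X (6 ℕ.* k ℕ.+ 10))

  lhs-suc : ∀ n → lhs (suc n) ≡ lhs n - summand n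
  lhs-suc n = begin
    (+ 3) ^ suc n * altBinom (suc n) h
      ≡⟨ move-3 ((+ 3) ^ n) (altBinom (suc n) h) ⟩
    (+ 3) ^ n * (+ 3 * altBinom (suc n) h)
      ≡⟨ cong ((+ 3) ^ n *_) (sym (altBinom-*ˡ (suc n) (+ 3) h)) ⟩
    (+ 3) ^ n * altBinom (suc n) (λ k → + 3 * h k)
      ≡⟨ cong ((+ 3) ^ n *_) (trans (altBinom-cong (suc n) triple-h) (altBinom-+ (suc n) g (g ∘ suc))) ⟩
    (+ 3) ^ n * (altBinom (suc n) g + altBinom (suc n) (g ∘ suc))
      ≡⟨ cong ((+ 3) ^ n *_) (altBinom-suc n g) ⟩
    (+ 3) ^ n * (altBinom n g - neg1^ n * B * (g (suc n) + + 2 * g (suc (suc n))))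
      ≡⟨ cong (λ t → (+ 3) ^ n * (altBinom n g - neg1^ n * B * t)) boundary ⟩
    (+ 3) ^ n * (altBinom n g - neg1^ n * B * t)
      ≡⟨ distribute ((+ 3) ^ n) (altBinom n g) (neg1^ n) B t ⟩
    lhs n - neg1^ n * (+ 3) ^ n * B * t
      ≡⟨ cong (λ s → lhs n - s * B * t) (sym (neg3^≡neg1^*3^ n)) ⟩
    lhs n - summand n
      ∎
    where
    open ≡-Reasoning
    g h : ℕ → ℤ
    g k = X (2 ℕ.* (n ℕ.+ 1 ℕ.+ 2 ℕ.* k))
    h k = X (2 ℕ.* (suc n ℕ.+ 1 ℕ.+ 2 ℕ.* k))
    B t : ℤ
    B = + ((2 ℕ.* n ℕ.+ 1) C n)
    t = + 3 * X (6 ℕ.* n ℕ.+ 8) + X (6 ℕ.* n ℕ.+ 10)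
    triple-h : ∀ k → + 3 * h k ≡ g k + g (suc k)
    triple-h k = begin
      + 3 * h k                   ≡⟨ cong (λ i → + 3 * X i) (index₁ n k) ⟩
      + 3 * X (2 ℕ.+ i)           ≡⟨ sym (X[4+j]+Xj≡3*X[2+j] i) ⟩
      X (4 ℕ.+ i) + g k           ≡⟨ cong (λ i → X i + g k) (index₂ n k) ⟩
      g (suc k) + g k             ≡⟨ ℤP.+-comm (g (suc k)) (g k) ⟩
      g k + g (suc k)             ∎
      where
      i = 2 ℕ.* (n ℕ.+ 1 ℕ.+ 2 ℕ.* k)
      index₁ : ∀ n k → 2 ℕ.* (suc n ℕ.+ 1 ℕ.+ 2 ℕ.* k) ≡ 2 ℕ.+ 2 ℕ.* (n ℕ.+ 1 ℕ.+ 2 ℕ.* k)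
      index₁ = ℕSolver.solve-∀
      index₂ : ∀ n k → 4 ℕ.+ 2 ℕ.* (n ℕ.+ 1 ℕ.+ 2 ℕ.* k) ≡ 2 ℕ.* (n ℕ.+ 1 ℕ.+ 2 ℕ.* suc k)
      index₂ = ℕSolver.solve-∀
    boundary : g (suc n) + + 2 * g (suc (suc n)) ≡ t
    boundary = begin
      g (suc n) + + 2 * g (suc (suc n))     ≡⟨ cong₂ (λ y z → X y + + 2 * X z) (index₁ n) (index₂ n) ⟩
      X j + + 2 * X (4 ℕ.+ j)               ≡⟨ regroup (X j) (X (4 ℕ.+ j)) ⟩
      (X (4 ℕ.+ j) + X j) + X (4 ℕ.+ j)     ≡⟨ cong₂ _+_ (X[4+j]+Xj≡3*X[2+j] j) (cong X (index₃ n)) ⟩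
      + 3 * X (2 ℕ.+ j) + X (6 ℕ.* n ℕ.+ 10) ≡⟨ cong (λ m → + 3 * X m + X (6 ℕ.* n ℕ.+ 10)) (index₄ n) ⟩
      t                                     ∎
      where
      j = 6 ℕ.* n ℕ.+ 6
      index₁ : ∀ n → 2 ℕ.* (n ℕ.+ 1 ℕ.+ 2 ℕ.* suc n) ≡ 6 ℕ.* n ℕ.+ 6
      index₁ = ℕSolver.solve-∀
      index₂ : ∀ n → 2 ℕ.* (n ℕ.+ 1 ℕ.+ 2 ℕ.* suc (suc n)) ≡ 4 ℕ.+ (6 ℕ.* n ℕ.+ 6)
      index₂ = ℕSolver.solve-∀
      index₃ : ∀ n → 4 ℕ.+ (6 ℕ.* n ℕ.+ 6) ≡ 6 ℕ.* n ℕ.+ 10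
      index₃ = ℕSolver.solve-∀
      index₄ : ∀ n → 2 ℕ.+ (6 ℕ.* n ℕ.+ 6) ≡ 6 ℕ.* n ℕ.+ 8
      index₄ = ℕSolver.solve-∀
      regroup : ∀ y z → y + + 2 * z ≡ (z + y) + z
      regroup = solve-∀
    move-3 : ∀ p a → (+ 3 * p) * a ≡ p * (+ 3 * a)
    move-3 = solve-∀
    distribute : ∀ p a s b u → p * (a - s * b * u) ≡ p * a - s * p * b * u
    distribute = solve-∀

  lhs≡X2-sum : ∀ n → lhs n ≡ X 2 - sumBelow n summand
  lhs≡X2-sum zero    = base (X 2)
    where
    base : ∀ a → + 1 * (+ 0 + + 1 * + 1 * a) ≡ a - + 0
    base = solve-∀
  lhs≡X2-sum (suc n) = begin
    lhs (suc n)                               ≡⟨ lhs-suc n ⟩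
    lhs n - summand n                         ≡⟨ cong (_- summand n) (lhs≡X2-sum n) ⟩
    (X 2 - sumBelow n summand) - summand n    ≡⟨ subtract-twice (X 2) (sumBelow n summand) (summand n) ⟩
    X 2 - sumBelow (suc n) summand            ∎
    where
    open ≡-Reasoning
    subtract-twice : ∀ a b c → (a - b) - c ≡ a - (b + c)
    subtract-twice = solve-∀

theorem18 : (n : ℕ) →
    ((+ 3) ^ n * sumBelow (ℕ.suc n) (λ k → neg1^ k * + ((n ℕ.+ k) C k) * + F (2 ℕ.* (n ℕ.+ 1 ℕ.+ 2 ℕ.* k)))
      ≡ + 1 - sumBelow n (λ k → neg3^ k * + ((2 ℕ.* k ℕ.+ 1) C k) * (+ 3 * + F (6 ℕ.* k ℕ.+ 8) + + F (6 ℕ.* k ℕ.+ 10))))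
    ×
    ((+ 3) ^ n * sumBelow (ℕ.suc n) (λ k → neg1^ k * + ((n ℕ.+ k) C k) * + L (2 ℕ.* (n ℕ.+ 1 ℕ.+ 2 ℕ.* k)))
      ≡ + 3 - sumBelow n (λ k → neg3^ k * + ((2 ℕ.* k ℕ.+ 1) C k) * (+ 3 * + L (6 ℕ.* k ℕ.+ 8) + + L (6 ℕ.* k ℕ.+ 10))))
theorem18 n = FibonacciLike.lhs≡X2-sum (λ j → + F j) (λ j → refl) n
            , FibonacciLike.lhs≡X2-sum (λ j → + L j) (λ j → refl) n
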